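{- For integers $m\ge k\ge0$, \[ \frac{(-1)^{m-k}}{m+1}\binom{m+1}{m-k}B_{m-k}=\sum_{\ell=k}^m\frac{S(m,\ell)}{\ell+1}\bigl[s(\ell,k+1)+s(\ell,k)\bigr]. \]
   Context: $s(k,r)$ are the (signed) Stirling numbers of the first kind, defined by $x^{\underline{k}}=x(x-1)\cdots(x-k+1)=\sum_{r=0}^k s(k,r)x^r$ (with $s(k,r)=0$ for $r>k$ or $r<0$); $S(m,\ell)$ are the Stirling numbers of the second kind ($S(0,0)=1$, $S(m,0)=0$ for $m\ge1$). The Bernoulli numbers are $B_0=1$ and $B_k=-\frac{1}{k+1}\sum_{j=0}^{k-1}\binom{k+1}{j}B_j$ for $k\ge1$ (so $B_1=-1/2$). -}

module Defs where

open import Data.Nat as ℕ using (ℕ; zero; suc; _∸_)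
open import Data.Nat.Combinatorics using (_C_)
open import Data.Integer as ℤ using (ℤ; +_)
open import Data.Rational as ℚ using (ℚ; _/_; _+_; _*_; -_; 0ℚ; 1ℚ)
open import Data.List using (List; []; _∷_; _++_; length; lookup; reverse)
open import Data.Fin using (Fin)

-- Signed Stirling numbers of the first kind s(n,k):
-- x(x-1)...(x-n+1) = Σ_r s(n,r) x^r, i.e.
-- s(0,0)=1, s(0,k+1)=0, s(n+1,0)=0, s(n+1,k+1) = s(n,k) - n * s(n,k+1).
stirling1 : ℕ → ℕ → ℤ
stirling1 zero zero = + 1
stirling1 zero (suc k) = + 0
stirling1 (suc n) zero = + 0
stirling1 (suc n) (suc k) = stirling1 n k ℤ.- (+ n) ℤ.* stirling1 n (suc k)

stirling2 : ℕ → ℕ → ℕ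
stirling2 zero zero = 1
stirling2 zero (suc k) = 0
stirling2 (suc n) zero = 0
stirling2 (suc n) (suc k) = stirling2 n k ℕ.+ suc k ℕ.* stirling2 n (suc k)

ℕ→ℚ : ℕ → ℚ
ℕ→ℚ n = (+ n) / 1

ℤ→ℚ : ℤ → ℚ
ℤ→ℚ z = z / 1

sumℚ : ℕ → (ℕ → ℚ) → ℚ
sumℚ zero f = 0ℚ
sumℚ (suc n) f = sumℚ n f + f n

-- Σ_{ℓ=a}^{b} f ℓ  over ℚ (empty if b < a)
sumFromTo : ℕ → ℕ → (ℕ → ℚ) → ℚ
sumFromTo a b f = sumℚ (suc b ∸ a) (λ i → f (a ℕ.+ i))

-- Bernoulli numbers (B_1 = -1/2):
-- B_0 = 1, B_k = -1/(k+1) Σ_{j=0}^{k-1} C(k+1,j) B_j.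
-- bernoulliList n = [B_0, ..., B_{n-1}], built by recursion.
private
  getAt : List ℚ → ℕ → ℚ
  getAt [] _ = 0ℚ
  getAt (x ∷ xs) zero = x
  getAt (x ∷ xs) (suc i) = getAt xs i

  nextB : ℕ → List ℚ → ℚ
  nextB zero bs = 1ℚ
  nextB (suc k') bs =
    let k = suc k' in
    - ((+ 1 / suc k) * sumℚ k (λ j → ℕ→ℚ ((suc k) C j) * getAt bs j))

bernoulliList : ℕ → List ℚ
bernoulliList zero = []
bernoulliList (suc n) = let bs = bernoulliList n in bs ++ (nextB n bs ∷ [])

bernoulli : ℕ → ℚ
bernoulli n = getAt' (bernoulliList (suc n)) n
  where
  getAt' : List ℚ → ℕ → ℚ
  getAt' [] _ = 0ℚ
  getAt' (x ∷ xs) zero = x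
  getAt' (x ∷ xs) (suc i) = getAt' xs i

signℚ : ℕ → ℚ
signℚ zero = 1ℚ
signℚ (suc n) = - signℚ n

-- Both sides are coefficients of the power sum P(x) = Σ_{0 ≤ i ≤ x} i^m.  Summing
-- x^m = Σ_ℓ S(m,ℓ) x(x-1)⋯(x-ℓ+1) gives P(x) = Σ_ℓ S(m,ℓ) (x+1)x⋯(x-ℓ+1)/(ℓ+1),
-- whose coefficient of x^(k+1) is the right-hand side, while Faulhaber's formula
-- gives the left-hand side.  No evaluation of sums is needed: a polynomial of degree
-- m + 1 is determined up to its constant term by P(x) - P(x - 1) = x^m, so it suffices
-- to check this difference equation for both coefficient sequences.  On the Stirling
-- side it is the orthogonality of the two kinds of Stirling numbers; on the
-- Bernoulli side it reduces, after a trinomial revision, to the defining recurrence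
-- Σ_{i ≤ n} C(n+1,i) B_i = [n = 0].

module Submission where

open import Defs
open import Data.Nat as ℕ using (ℕ; zero; suc; _≤_; _<_; _∸_; z≤n; s≤s)
import Data.Nat.Properties as ℕP
open import Data.Nat.Combinatorics using (_C_; nCk+nC[k+1]≡[n+1]C[k+1]; nCn≡1; nC1≡n; nCk≡nC[n∸k])
open import Data.Nat.Combinatorics.Specification using (k>n⇒nCk≡0)
open import Data.Nat.Solver using (module +-*-Solver)
open import Data.Integer as ℤ using (+_)
import Data.Integer.Properties as ℤP
import Data.Integer.Solver as ℤSolver
open import Data.Rational using (ℚ; _/_; _+_; _*_; -_; _-_; 0ℚ; 1ℚ; toℚᵘ)
import Data.Rational.Properties as ℚP
open import Data.Rational.Solver using () renaming (module +-*-Solver to ℚSolver)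
import Data.Rational.Unnormalised as ℚᵘ
import Data.Rational.Unnormalised.Properties as ℚᵘP
open import Data.List using (List; []; _∷_; _++_; length; drop)
open import Data.List.Properties using (length-++)
open import Data.Product using (∃₂; _,_)
open import Data.Sum using (inj₁; inj₂)
open import Algebra.Properties.Group ℚP.+-0-group using (x∙y⁻¹≈ε⇒x≈y)
open import Relation.Binary.PropositionalEquality
open import Relation.Nullary using (Dec; yes; no)

ℤ→ℚ≃mkℚᵘ : ∀ z → toℚᵘ (ℤ→ℚ z) ℚᵘ.≃ ℚᵘ.mkℚᵘ z 0
ℤ→ℚ≃mkℚᵘ z = ℚP.toℚᵘ-fromℚᵘ (ℚᵘ.mkℚᵘ z 0)

ℤ→ℚ-+ : ∀ a b → ℤ→ℚ (a ℤ.+ b) ≡ ℤ→ℚ a + ℤ→ℚ b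
ℤ→ℚ-+ a b = ℚP.toℚᵘ-injective (begin
  toℚᵘ (ℤ→ℚ (a ℤ.+ b))                 ≈⟨ ℤ→ℚ≃mkℚᵘ (a ℤ.+ b) ⟩
  ℚᵘ.mkℚᵘ (a ℤ.+ b) 0                  ≈⟨ ℚᵘ.*≡* (solve 2 (λ x y → (x :+ y) :* con (+ 1) := (x :* con (+ 1) :+ y :* con (+ 1)) :* con (+ 1)) refl a b) ⟩
  ℚᵘ.mkℚᵘ a 0 ℚᵘ.+ ℚᵘ.mkℚᵘ b 0          ≈⟨ ℚᵘP.+-cong (ℤ→ℚ≃mkℚᵘ a) (ℤ→ℚ≃mkℚᵘ b) ⟨
  toℚᵘ (ℤ→ℚ a) ℚᵘ.+ toℚᵘ (ℤ→ℚ b)      ≈⟨ ℚP.toℚᵘ-homo-+ (ℤ→ℚ a) (ℤ→ℚ b) ⟨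
  toℚᵘ (ℤ→ℚ a + ℤ→ℚ b)                 ∎)
  where open ℚᵘP.≃-Reasoning; open ℤSolver.+-*-Solver

ℤ→ℚ-* : ∀ a b → ℤ→ℚ (a ℤ.* b) ≡ ℤ→ℚ a * ℤ→ℚ b
ℤ→ℚ-* a b = ℚP.toℚᵘ-injective (begin
  toℚᵘ (ℤ→ℚ (a ℤ.* b))                 ≈⟨ ℤ→ℚ≃mkℚᵘ (a ℤ.* b) ⟩
  ℚᵘ.mkℚᵘ (a ℤ.* b) 0                  ≈⟨ ℚᵘP.*-cong (ℤ→ℚ≃mkℚᵘ a) (ℤ→ℚ≃mkℚᵘ b) ⟨
  toℚᵘ (ℤ→ℚ a) ℚᵘ.* toℚᵘ (ℤ→ℚ b)      ≈⟨ ℚP.toℚᵘ-homo-* (ℤ→ℚ a) (ℤ→ℚ b) ⟨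
  toℚᵘ (ℤ→ℚ a * ℤ→ℚ b)                 ∎)
  where open ℚᵘP.≃-Reasoning

ℤ→ℚ-neg : ∀ a → ℤ→ℚ (ℤ.- a) ≡ - ℤ→ℚ a
ℤ→ℚ-neg a = ℚP.toℚᵘ-injective (begin
  toℚᵘ (ℤ→ℚ (ℤ.- a))                   ≈⟨ ℤ→ℚ≃mkℚᵘ (ℤ.- a) ⟩
  ℚᵘ.mkℚᵘ (ℤ.- a) 0                    ≈⟨ ℚᵘP.-‿cong (ℤ→ℚ≃mkℚᵘ a) ⟨
  ℚᵘ.- toℚᵘ (ℤ→ℚ a)                    ≈⟨ ℚP.toℚᵘ-homo‿- (ℤ→ℚ a) ⟨
  toℚᵘ (- ℤ→ℚ a)                       ∎)
  where open ℚᵘP.≃-Reasoning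

ℕ→ℚ-+ : ∀ a b → ℕ→ℚ (a ℕ.+ b) ≡ ℕ→ℚ a + ℕ→ℚ b
ℕ→ℚ-+ a b = ℤ→ℚ-+ (+ a) (+ b)

ℕ→ℚ-* : ∀ a b → ℕ→ℚ (a ℕ.* b) ≡ ℕ→ℚ a * ℕ→ℚ b
ℕ→ℚ-* a b = trans (cong ℤ→ℚ (ℤP.pos-* a b)) (ℤ→ℚ-* (+ a) (+ b))

ℕ→ℚ-suc : ∀ n → ℕ→ℚ (suc n) ≡ 1ℚ + ℕ→ℚ n
ℕ→ℚ-suc n = ℕ→ℚ-+ 1 n

1/suc : ℕ → ℚ
1/suc n = + 1 / suc n

1/suc-inverse : ∀ n → 1/suc n * ℕ→ℚ (suc n) ≡ 1ℚ
1/suc-inverse n = ℚP.toℚᵘ-injective (begin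
  toℚᵘ (1/suc n * ℕ→ℚ (suc n))                   ≈⟨ ℚP.toℚᵘ-homo-* (1/suc n) (ℕ→ℚ (suc n)) ⟩
  toℚᵘ (1/suc n) ℚᵘ.* toℚᵘ (ℕ→ℚ (suc n))         ≈⟨ ℚᵘP.*-cong (ℚP.toℚᵘ-fromℚᵘ (ℚᵘ.mkℚᵘ (+ 1) n)) (ℤ→ℚ≃mkℚᵘ (+ suc n)) ⟩
  ℚᵘ.mkℚᵘ (+ 1) n ℚᵘ.* ℚᵘ.mkℚᵘ (+ suc n) 0       ≈⟨ ℚᵘ.*≡* (cong +_ (solve 1 (λ k → (con 1 :* (con 1 :+ k)) :* con 1 := con 1 :* ((con 1 :+ k) :* con 1)) refl n)) ⟩
  toℚᵘ 1ℚ                                         ∎)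
  where open ℚᵘP.≃-Reasoning; open +-*-Solver

sumℚ-cong : ∀ n {f g : ℕ → ℚ} → (∀ i → i < n → f i ≡ g i) → sumℚ n f ≡ sumℚ n g
sumℚ-cong zero    f≗g = refl
sumℚ-cong (suc n) f≗g = cong₂ _+_ (sumℚ-cong n (λ i i<n → f≗g i (ℕP.m<n⇒m<1+n i<n))) (f≗g n (ℕP.n<1+n n))

sumℚ-zero : ∀ n {f : ℕ → ℚ} → (∀ i → i < n → f i ≡ 0ℚ) → sumℚ n f ≡ 0ℚ
sumℚ-zero n {f} f≗0 = trans (sumℚ-cong n f≗0) (sumℚ-const-0 n)
  where
  sumℚ-const-0 : ∀ n → sumℚ n (λ _ → 0ℚ) ≡ 0ℚ
  sumℚ-const-0 zero    = refl
  sumℚ-const-0 (suc n) = cong (_+ 0ℚ) (sumℚ-const-0 n)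

sumℚ-+ : ∀ n (f g : ℕ → ℚ) → sumℚ n (λ i → f i + g i) ≡ sumℚ n f + sumℚ n g
sumℚ-+ zero    f g = refl
sumℚ-+ (suc n) f g = trans (cong (_+ (f n + g n)) (sumℚ-+ n f g))
  (solve 4 (λ a b c d → (a :+ b) :+ (c :+ d) := (a :+ c) :+ (b :+ d)) refl (sumℚ n f) (sumℚ n g) (f n) (g n))
  where open ℚSolver

sumℚ-neg : ∀ n (f : ℕ → ℚ) → sumℚ n (λ i → - f i) ≡ - sumℚ n f
sumℚ-neg zero    f = refl
sumℚ-neg (suc n) f = trans (cong (_+ (- f n)) (sumℚ-neg n f)) (sym (ℚP.neg-distrib-+ (sumℚ n f) (f n)))

sumℚ-sub : ∀ n (f g : ℕ → ℚ) → sumℚ n (λ i → f i - g i) ≡ sumℚ n f - sumℚ n g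
sumℚ-sub n f g = trans (sumℚ-+ n f (λ i → - g i)) (cong (λ x → sumℚ n f + x) (sumℚ-neg n g))

sumℚ-*ˡ : ∀ n c (f : ℕ → ℚ) → c * sumℚ n f ≡ sumℚ n (λ i → c * f i)
sumℚ-*ˡ zero    c f = ℚP.*-zeroʳ c
sumℚ-*ˡ (suc n) c f = trans (ℚP.*-distribˡ-+ c (sumℚ n f) (f n)) (cong (_+ (c * f n)) (sumℚ-*ˡ n c f))

sumℚ-suc-head : ∀ n (f : ℕ → ℚ) → sumℚ (suc n) f ≡ f 0 + sumℚ n (λ i → f (suc i))
sumℚ-suc-head zero    f = trans (ℚP.+-identityˡ (f 0)) (sym (ℚP.+-identityʳ (f 0)))
sumℚ-suc-head (suc n) f = trans (cong (_+ f (suc n)) (sumℚ-suc-head n f)) (ℚP.+-assoc (f 0) _ _)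

sumℚ-split : ∀ a b (f : ℕ → ℚ) → sumℚ (a ℕ.+ b) f ≡ sumℚ a f + sumℚ b (λ i → f (a ℕ.+ i))
sumℚ-split a zero    f = trans (cong (λ n → sumℚ n f) (ℕP.+-identityʳ a)) (sym (ℚP.+-identityʳ _))
sumℚ-split a (suc b) f = begin
  sumℚ (a ℕ.+ suc b) f                                           ≡⟨ cong (λ n → sumℚ n f) (ℕP.+-suc a b) ⟩
  sumℚ (a ℕ.+ b) f + f (a ℕ.+ b)                                 ≡⟨ cong (_+ f (a ℕ.+ b)) (sumℚ-split a b f) ⟩
  (sumℚ a f + sumℚ b (λ i → f (a ℕ.+ i))) + f (a ℕ.+ b)          ≡⟨ ℚP.+-assoc (sumℚ a f) _ _ ⟩
  sumℚ a f + sumℚ (suc b) (λ i → f (a ℕ.+ i))                    ∎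
  where open ≡-Reasoning

sumℚ-low-zero : ∀ a b {f : ℕ → ℚ} → (∀ i → i < a → f i ≡ 0ℚ) → sumℚ (a ℕ.+ b) f ≡ sumℚ b (λ i → f (a ℕ.+ i))
sumℚ-low-zero a b {f} f≗0 = trans (sumℚ-split a b f) (trans (cong (_+ sumℚ b (λ i → f (a ℕ.+ i))) (sumℚ-zero a f≗0)) (ℚP.+-identityˡ _))

sumℚ-high-zero : ∀ a b {f : ℕ → ℚ} → (∀ i → f (a ℕ.+ i) ≡ 0ℚ) → sumℚ (a ℕ.+ b) f ≡ sumℚ a f
sumℚ-high-zero a b {f} f≗0 = trans (sumℚ-split a b f) (trans (cong (λ x → sumℚ a f + x) (sumℚ-zero b (λ i _ → f≗0 i))) (ℚP.+-identityʳ _))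

sumℚ≡sumFromTo : ∀ {k m} {f : ℕ → ℚ} → k ≤ suc m → (∀ i → i < k → f i ≡ 0ℚ) → sumℚ (suc m) f ≡ sumFromTo k m f
sumℚ≡sumFromTo {k} {m} {f} k≤1+m f≗0 = trans (cong (λ n → sumℚ n f) (sym (ℕP.m+[n∸m]≡n k≤1+m))) (sumℚ-low-zero k (suc m ∸ k) f≗0)

sumℚ-comm : ∀ n m (f : ℕ → ℕ → ℚ) → sumℚ n (λ i → sumℚ m (f i)) ≡ sumℚ m (λ j → sumℚ n (λ i → f i j))
sumℚ-comm zero    m f = sym (sumℚ-zero m (λ _ _ → refl))
sumℚ-comm (suc n) m f = trans (cong (_+ sumℚ m (f n)) (sumℚ-comm n m f)) (sym (sumℚ-+ m (λ j → sumℚ n (λ i → f i j)) (f n)))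

sumℚ-reverse : ∀ n (f : ℕ → ℚ) → sumℚ n f ≡ sumℚ n (λ i → f (n ∸ suc i))
sumℚ-reverse zero    f = refl
sumℚ-reverse (suc n) f = trans (cong (_+ f n) (sumℚ-reverse n f))
  (trans (ℚP.+-comm _ (f n)) (sym (sumℚ-suc-head n (λ i → f (suc n ∸ suc i)))))

sumℚ-telescope : ∀ n (g : ℕ → ℚ) → sumℚ n (λ i → g (suc i) - g i) ≡ g n - g 0
sumℚ-telescope zero    g = sym (ℚP.+-inverseʳ (g 0))
sumℚ-telescope (suc n) g = trans (cong (_+ (g (suc n) - g n)) (sumℚ-telescope n g))
  (solve 3 (λ a b c → (a :- c) :+ (b :- a) := b :- c) refl (g n) (g (suc n)) (g 0))
  where open ℚSolver

pascal : ∀ n k → suc n C suc k ≡ n C k ℕ.+ n C suc k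
pascal n k = sym (nCk+nC[k+1]≡[n+1]C[k+1] n k)

C-+-sym : ∀ a b → (a ℕ.+ b) C a ≡ (a ℕ.+ b) C b
C-+-sym a b = trans (nCk≡nC[n∸k] (ℕP.m≤m+n a b)) (cong ((a ℕ.+ b) C_) (ℕP.m+n∸m≡n a b))

C-suc-absorb : ∀ n k → suc k ℕ.* (suc n C suc k) ≡ suc n ℕ.* (n C k)
C-suc-absorb zero    zero    = refl
C-suc-absorb zero    (suc k) rewrite k>n⇒nCk≡0 {1} {suc (suc k)} (s≤s (s≤s z≤n)) | k>n⇒nCk≡0 {0} {suc k} (s≤s z≤n) = ℕP.*-zeroʳ (suc (suc k))
C-suc-absorb (suc n) zero    = trans (ℕP.+-identityʳ _) (trans (nC1≡n (suc (suc n))) (sym (ℕP.*-identityʳ (suc (suc n)))))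
C-suc-absorb (suc n) (suc k) = begin
  suc (suc k) ℕ.* (suc (suc n) C suc (suc k))  ≡⟨ cong (suc (suc k) ℕ.*_) (pascal (suc n) (suc k)) ⟩
  suc (suc k) ℕ.* (A ℕ.+ B)                    ≡⟨ solve 3 (λ k A B → (con 2 :+ k) :* (A :+ B) := (con 1 :+ k) :* A :+ A :+ (con 2 :+ k) :* B) refl k A B ⟩
  suc k ℕ.* A ℕ.+ A ℕ.+ suc (suc k) ℕ.* B      ≡⟨ cong₂ (λ x y → x ℕ.+ A ℕ.+ y) (C-suc-absorb n k) (C-suc-absorb n (suc k)) ⟩
  suc n ℕ.* X ℕ.+ A ℕ.+ suc n ℕ.* Y            ≡⟨ solve 4 (λ n X A Y → (con 1 :+ n) :* X :+ A :+ (con 1 :+ n) :* Y := (con 1 :+ n) :* (X :+ Y) :+ A) refl n X A Y ⟩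
  suc n ℕ.* (X ℕ.+ Y) ℕ.+ A                    ≡⟨ cong (λ z → suc n ℕ.* z ℕ.+ A) (sym (pascal n k)) ⟩
  suc n ℕ.* A ℕ.+ A                            ≡⟨ solve 2 (λ n A → (con 1 :+ n) :* A :+ A := (con 2 :+ n) :* A) refl n A ⟩
  suc (suc n) ℕ.* A                            ∎
  where
  open ≡-Reasoning
  open +-*-Solver
  A = suc n C suc k
  B = suc n C suc (suc k)
  X = n C k
  Y = n C suc k

C-trinomial : ∀ r s t → ((r ℕ.+ s ℕ.+ t) C (r ℕ.+ s)) ℕ.* ((r ℕ.+ s) C r) ≡ ((r ℕ.+ s ℕ.+ t) C r) ℕ.* ((s ℕ.+ t) C s)
C-trinomial zero    s t = trans (ℕP.*-identityʳ ((s ℕ.+ t) C s)) (sym (ℕP.*-identityˡ ((s ℕ.+ t) C s)))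
C-trinomial (suc r) s t = ℕP.*-cancelˡ-≡ _ _ (suc K ℕ.* suc r) (begin
  suc K ℕ.* suc r ℕ.* ((suc R C suc K) ℕ.* (suc K C suc r))       ≡⟨ solve 4 (λ a b c d → a :* b :* (c :* d) := (a :* c) :* (b :* d)) refl (suc K) (suc r) (suc R C suc K) (suc K C suc r) ⟩
  (suc K ℕ.* (suc R C suc K)) ℕ.* (suc r ℕ.* (suc K C suc r))     ≡⟨ cong₂ ℕ._*_ (C-suc-absorb R K) (C-suc-absorb K r) ⟩
  (suc R ℕ.* (R C K)) ℕ.* (suc K ℕ.* (K C r))                     ≡⟨ solve 4 (λ a b c d → (a :* c) :* (b :* d) := b :* a :* (c :* d)) refl (suc R) (suc K) (R C K) (K C r) ⟩
  suc K ℕ.* suc R ℕ.* ((R C K) ℕ.* (K C r))                       ≡⟨ cong (suc K ℕ.* suc R ℕ.*_) (C-trinomial r s t) ⟩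
  suc K ℕ.* suc R ℕ.* ((R C r) ℕ.* ((s ℕ.+ t) C s))               ≡⟨ solve 4 (λ a b c d → a :* b :* (c :* d) := a :* (b :* c) :* d) refl (suc K) (suc R) (R C r) ((s ℕ.+ t) C s) ⟩
  suc K ℕ.* (suc R ℕ.* (R C r)) ℕ.* ((s ℕ.+ t) C s)               ≡⟨ cong (λ z → suc K ℕ.* z ℕ.* ((s ℕ.+ t) C s)) (sym (C-suc-absorb R r)) ⟩
  suc K ℕ.* (suc r ℕ.* (suc R C suc r)) ℕ.* ((s ℕ.+ t) C s)       ≡⟨ solve 4 (λ a b c d → a :* (b :* c) :* d := a :* b :* (c :* d)) refl (suc K) (suc r) (suc R C suc r) ((s ℕ.+ t) C s) ⟩
  suc K ℕ.* suc r ℕ.* ((suc R C suc r) ℕ.* ((s ℕ.+ t) C s))       ∎)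
  where
  open ≡-Reasoning
  open +-*-Solver
  K = r ℕ.+ s
  R = r ℕ.+ s ℕ.+ t

mulX : (ℕ → ℚ) → ℕ → ℚ
mulX p zero    = 0ℚ
mulX p (suc j) = p j

δ : ℕ → ℕ → ℚ
δ zero    zero    = 1ℚ
δ zero    (suc r) = 0ℚ
δ (suc m) zero    = 0ℚ
δ (suc m) (suc r) = δ m r

s₁ : ℕ → ℕ → ℚ
s₁ n k = ℤ→ℚ (stirling1 n k)

S₂ : ℕ → ℕ → ℚ
S₂ n k = ℕ→ℚ (stirling2 n k)

stirling1-vanish : ∀ {n k} → n < k → stirling1 n k ≡ + 0
stirling1-vanish {zero}  {suc k} _ = refl
stirling1-vanish {suc n} {suc k} (s≤s n<k)
  rewrite stirling1-vanish n<k | stirling1-vanish (ℕP.m<n⇒m<1+n n<k) | ℤP.*-zeroʳ (+ n) = refl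

stirling2-vanish : ∀ {n k} → n < k → stirling2 n k ≡ 0
stirling2-vanish {zero}  {suc k} _ = refl
stirling2-vanish {suc n} {suc k} (s≤s n<k)
  rewrite stirling2-vanish n<k | stirling2-vanish (ℕP.m<n⇒m<1+n n<k) = ℕP.*-zeroʳ k

s₁-vanish : ∀ {n k} → n < k → s₁ n k ≡ 0ℚ
s₁-vanish n<k = cong ℤ→ℚ (stirling1-vanish n<k)

S₂-vanish : ∀ {n k} → n < k → S₂ n k ≡ 0ℚ
S₂-vanish n<k = cong ℕ→ℚ (stirling2-vanish n<k)

s₁-suc-suc : ∀ n k → s₁ (suc n) (suc k) ≡ s₁ n k - ℕ→ℚ n * s₁ n (suc k)
s₁-suc-suc n k = begin
  ℤ→ℚ (stirling1 n k ℤ.- + n ℤ.* stirling1 n (suc k))     ≡⟨ ℤ→ℚ-+ (stirling1 n k) (ℤ.- (+ n ℤ.* stirling1 n (suc k))) ⟩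
  s₁ n k + ℤ→ℚ (ℤ.- (+ n ℤ.* stirling1 n (suc k)))         ≡⟨ cong (λ x → s₁ n k + x) (ℤ→ℚ-neg (+ n ℤ.* stirling1 n (suc k))) ⟩
  s₁ n k - ℤ→ℚ (+ n ℤ.* stirling1 n (suc k))               ≡⟨ cong (λ x → s₁ n k - x) (ℤ→ℚ-* (+ n) (stirling1 n (suc k))) ⟩
  s₁ n k - ℕ→ℚ n * s₁ n (suc k)                            ∎
  where open ≡-Reasoning

-- x(x-1)⋯(x-n) = x(x-1)⋯(x-n+1) · (x - n), coefficientwise
s₁-suc : ∀ n k → s₁ (suc n) k ≡ mulX (s₁ n) k - ℕ→ℚ n * s₁ n k
s₁-suc n       (suc k) = s₁-suc-suc n k
s₁-suc zero    zero    = refl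
s₁-suc (suc n) zero    = cong (λ x → 0ℚ - x) (sym (ℚP.*-zeroʳ (ℕ→ℚ (suc n))))

S₂-suc-suc : ∀ m l → S₂ (suc m) (suc l) ≡ S₂ m l + ℕ→ℚ (suc l) * S₂ m (suc l)
S₂-suc-suc m l = trans (ℕ→ℚ-+ (stirling2 m l) (suc l ℕ.* stirling2 m (suc l))) (cong (λ x → S₂ m l + x) (ℕ→ℚ-* (suc l) (stirling2 m (suc l))))

S₂-s₁-orthogonal : ∀ m r → sumℚ (suc m) (λ l → S₂ m l * s₁ l r) ≡ δ m r
S₂-s₁-orthogonal zero    zero    = refl
S₂-s₁-orthogonal zero    (suc r) = refl
S₂-s₁-orthogonal (suc m) r = begin
  sumℚ (suc (suc m)) (λ l → S₂ (suc m) l * s₁ l r)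
    ≡⟨ sumℚ-suc-head (suc m) (λ l → S₂ (suc m) l * s₁ l r) ⟩
  0ℚ * s₁ 0 r + sumℚ (suc m) (λ l → S₂ (suc m) (suc l) * s₁ (suc l) r)
    ≡⟨ cong (_+ sumℚ (suc m) (λ l → S₂ (suc m) (suc l) * s₁ (suc l) r)) (ℚP.*-zeroˡ (s₁ 0 r)) ⟩
  0ℚ + sumℚ (suc m) (λ l → S₂ (suc m) (suc l) * s₁ (suc l) r)
    ≡⟨ ℚP.+-identityˡ _ ⟩
  sumℚ (suc m) (λ l → S₂ (suc m) (suc l) * s₁ (suc l) r)
    ≡⟨ shifted r ⟩
  δ (suc m) r ∎
  where
  open ≡-Reasoning
  open ℚSolver
  shifted : ∀ r → sumℚ (suc m) (λ l → S₂ (suc m) (suc l) * s₁ (suc l) r) ≡ δ (suc m) r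
  shifted zero    = sumℚ-zero (suc m) (λ l _ → ℚP.*-zeroʳ (S₂ (suc m) (suc l)))
  shifted (suc r) = begin
    sumℚ (suc m) (λ l → S₂ (suc m) (suc l) * s₁ (suc l) (suc r))
      ≡⟨ sumℚ-cong (suc m) (λ l _ → step l) ⟩
    sumℚ (suc m) (λ l → S₂ m l * s₁ l r + (g (suc l) - g l))
      ≡⟨ sumℚ-+ (suc m) (λ l → S₂ m l * s₁ l r) (λ l → g (suc l) - g l) ⟩
    sumℚ (suc m) (λ l → S₂ m l * s₁ l r) + sumℚ (suc m) (λ l → g (suc l) - g l)
      ≡⟨ cong₂ _+_ (S₂-s₁-orthogonal m r) (sumℚ-telescope (suc m) g) ⟩
    δ m r + (g (suc m) - g 0)
      ≡⟨ cong₂ (λ x y → δ m r + (x - y)) g-top g-bottom ⟩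
    δ m r + 0ℚ
      ≡⟨ ℚP.+-identityʳ (δ m r) ⟩
    δ m r ∎
    where
    g : ℕ → ℚ
    g l = ℕ→ℚ l * S₂ m l * s₁ l (suc r)
    g-bottom : g 0 ≡ 0ℚ
    g-bottom = solve 2 (λ a b → con 0ℚ :* a :* b := con 0ℚ) refl (S₂ m 0) (s₁ 0 (suc r))
    g-top : g (suc m) ≡ 0ℚ
    g-top = trans (cong (λ x → ℕ→ℚ (suc m) * x * s₁ (suc m) (suc r)) (S₂-vanish (ℕP.n<1+n m)))
      (solve 2 (λ a b → a :* con 0ℚ :* b := con 0ℚ) refl (ℕ→ℚ (suc m)) (s₁ (suc m) (suc r)))
    step : ∀ l → S₂ (suc m) (suc l) * s₁ (suc l) (suc r) ≡ S₂ m l * s₁ l r + (g (suc l) - g l)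
    step l = begin
      S₂ (suc m) (suc l) * s₁ (suc l) (suc r)
        ≡⟨ cong (_* s₁ (suc l) (suc r)) (S₂-suc-suc m l) ⟩
      (S₂ m l + ℕ→ℚ (suc l) * S₂ m (suc l)) * s₁ (suc l) (suc r)
        ≡⟨ ℚP.*-distribʳ-+ (s₁ (suc l) (suc r)) (S₂ m l) _ ⟩
      S₂ m l * s₁ (suc l) (suc r) + g (suc l)
        ≡⟨ cong (λ x → S₂ m l * x + g (suc l)) (s₁-suc-suc l r) ⟩
      S₂ m l * (s₁ l r - ℕ→ℚ l * s₁ l (suc r)) + g (suc l)
        ≡⟨ solve 5 (λ S a L b G → S :* (a :- L :* b) :+ G := S :* a :+ (G :- L :* S :* b)) refl
             (S₂ m l) (s₁ l r) (ℕ→ℚ l) (s₁ l (suc r)) (g (suc l)) ⟩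
      S₂ m l * s₁ l r + (g (suc l) - g l) ∎

-- Polynomials as coefficient sequences

signℚ-+ : ∀ a b → signℚ (a ℕ.+ b) ≡ signℚ a * signℚ b
signℚ-+ zero    b = sym (ℚP.*-identityˡ (signℚ b))
signℚ-+ (suc a) b = trans (cong -_ (signℚ-+ a b)) (ℚP.neg-distribˡ-* (signℚ a) (signℚ b))

signℚ-∸-suc : ∀ {j r} → r < j → signℚ (j ∸ r) ≡ - signℚ (j ∸ suc r)
signℚ-∸-suc {suc j} {zero}  _          = refl
signℚ-∸-suc {suc j} {suc r} (s≤s r<j) = signℚ-∸-suc r<j

pow[x-1] : ℕ → ℕ → ℚ
pow[x-1] j r = ℕ→ℚ (j C r) * signℚ (j ∸ r)

pow[x-1]-vanish : ∀ {j r} → j < r → pow[x-1] j r ≡ 0ℚ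
pow[x-1]-vanish {j} {r} j<r = trans (cong (λ c → ℕ→ℚ c * signℚ (j ∸ r)) (k>n⇒nCk≡0 j<r)) (ℚP.*-zeroˡ (signℚ (j ∸ r)))

pow[x-1]-diag : ∀ r → pow[x-1] r r ≡ 1ℚ
pow[x-1]-diag r = cong₂ (λ c e → ℕ→ℚ c * signℚ e) (nCn≡1 r) (ℕP.n∸n≡0 r)

pow[x-1]-sub-diag : ∀ r → pow[x-1] (suc r) r ≡ - ℕ→ℚ (suc r)
pow[x-1]-sub-diag r = begin
  ℕ→ℚ (suc r C r) * signℚ (suc r ∸ r)   ≡⟨ cong₂ (λ c e → ℕ→ℚ c * signℚ e) (trans (sym (C-+-sym 1 r)) (nC1≡n (suc r))) (ℕP.m+n∸n≡m 1 r) ⟩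
  ℕ→ℚ (suc r) * - 1ℚ                    ≡⟨ ℚP.neg-distribʳ-* (ℕ→ℚ (suc r)) 1ℚ ⟨
  - (ℕ→ℚ (suc r) * 1ℚ)                  ≡⟨ cong -_ (ℚP.*-identityʳ (ℕ→ℚ (suc r))) ⟩
  - ℕ→ℚ (suc r)                         ∎
  where open ≡-Reasoning

-- (x-1)^(j+1) = x (x-1)^j - (x-1)^j, coefficientwise
pow[x-1]-suc : ∀ j r → pow[x-1] (suc j) r ≡ mulX (pow[x-1] j) r - pow[x-1] j r
pow[x-1]-suc j zero    = trans (sym (ℚP.neg-distribʳ-* 1ℚ (signℚ j))) (sym (ℚP.+-identityˡ (- pow[x-1] j 0)))
pow[x-1]-suc j (suc r) = begin
  ℕ→ℚ (suc j C suc r) * signℚ (j ∸ r)                                ≡⟨ cong (λ c → ℕ→ℚ c * signℚ (j ∸ r)) (pascal j r) ⟩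
  ℕ→ℚ (j C r ℕ.+ j C suc r) * signℚ (j ∸ r)                          ≡⟨ cong (_* signℚ (j ∸ r)) (ℕ→ℚ-+ (j C r) (j C suc r)) ⟩
  (ℕ→ℚ (j C r) + ℕ→ℚ (j C suc r)) * signℚ (j ∸ r)                    ≡⟨ ℚP.*-distribʳ-+ (signℚ (j ∸ r)) (ℕ→ℚ (j C r)) _ ⟩
  pow[x-1] j r + ℕ→ℚ (j C suc r) * signℚ (j ∸ r)                     ≡⟨ cong (λ x → pow[x-1] j r + x) (shifted-sign (r ℕ.<? j)) ⟩
  pow[x-1] j r - pow[x-1] j (suc r)                                   ∎
  where
  open ≡-Reasoning
  shifted-sign : Dec (r < j) → ℕ→ℚ (j C suc r) * signℚ (j ∸ r) ≡ - pow[x-1] j (suc r)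
  shifted-sign (yes r<j) = trans (cong (ℕ→ℚ (j C suc r) *_) (signℚ-∸-suc r<j)) (sym (ℚP.neg-distribʳ-* (ℕ→ℚ (j C suc r)) (signℚ (j ∸ suc r))))
  shifted-sign (no r≮j) rewrite k>n⇒nCk≡0 {j} {suc r} (s≤s (ℕP.≮⇒≥ r≮j)) =
    trans (ℚP.*-zeroˡ (signℚ (j ∸ r))) (cong -_ (sym (ℚP.*-zeroˡ (signℚ (j ∸ suc r)))))

-- The coefficients of p(x - 1), for p of degree below N.
atPred : ℕ → (ℕ → ℚ) → ℕ → ℚ
atPred N p r = sumℚ N (λ j → p j * pow[x-1] j r)

∇ : ℕ → (ℕ → ℚ) → ℕ → ℚ
∇ N p r = p r - atPred N p r

VanishesFrom : (ℕ → ℚ) → ℕ → Set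
VanishesFrom p n = ∀ j → n ≤ j → p j ≡ 0ℚ

atPred-cong : ∀ N {p q : ℕ → ℚ} r → (∀ j → p j ≡ q j) → atPred N p r ≡ atPred N q r
atPred-cong N r p≗q = sumℚ-cong N (λ j _ → cong (_* pow[x-1] j r) (p≗q j))

atPred-sub : ∀ N (p q : ℕ → ℚ) r → atPred N (λ j → p j - q j) r ≡ atPred N p r - atPred N q r
atPred-sub N p q r = trans
  (sumℚ-cong N (λ j _ → solve 3 (λ a b w → (a :- b) :* w := a :* w :- b :* w) refl (p j) (q j) (pow[x-1] j r)))
  (sumℚ-sub N (λ j → p j * pow[x-1] j r) (λ j → q j * pow[x-1] j r))
  where open ℚSolver

atPred-*ˡ : ∀ N c (p : ℕ → ℚ) r → atPred N (λ j → c * p j) r ≡ c * atPred N p r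
atPred-*ˡ N c p r = trans (sumℚ-cong N (λ j _ → ℚP.*-assoc c (p j) (pow[x-1] j r))) (sym (sumℚ-*ˡ N c (λ j → p j * pow[x-1] j r)))

atPred-sumℚ : ∀ N M (f : ℕ → ℕ → ℚ) r → atPred N (λ j → sumℚ M (λ l → f l j)) r ≡ sumℚ M (λ l → atPred N (f l) r)
atPred-sumℚ N M f r = begin
  sumℚ N (λ j → sumℚ M (λ l → f l j) * pow[x-1] j r)   ≡⟨ sumℚ-cong N (λ j _ → ℚP.*-comm (sumℚ M (λ l → f l j)) _) ⟩
  sumℚ N (λ j → pow[x-1] j r * sumℚ M (λ l → f l j))   ≡⟨ sumℚ-cong N (λ j _ → sumℚ-*ˡ M (pow[x-1] j r) (λ l → f l j)) ⟩
  sumℚ N (λ j → sumℚ M (λ l → pow[x-1] j r * f l j))   ≡⟨ sumℚ-comm N M (λ j l → pow[x-1] j r * f l j) ⟩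
  sumℚ M (λ l → sumℚ N (λ j → pow[x-1] j r * f l j))   ≡⟨ sumℚ-cong M (λ l _ → sumℚ-cong N (λ j _ → ℚP.*-comm _ (f l j))) ⟩
  sumℚ M (λ l → atPred N (f l) r)                        ∎
  where open ≡-Reasoning

-- (x p)(x - 1) = (x - 1) p(x - 1)
atPred-mulX : ∀ N (p : ℕ → ℚ) r → atPred (suc N) (mulX p) r ≡ mulX (atPred N p) r - atPred N p r
atPred-mulX N p r = begin
  atPred (suc N) (mulX p) r                                              ≡⟨ sumℚ-suc-head N (λ j → mulX p j * pow[x-1] j r) ⟩
  0ℚ * pow[x-1] 0 r + sumℚ N (λ j → p j * pow[x-1] (suc j) r)            ≡⟨ cong (_+ sumℚ N (λ j → p j * pow[x-1] (suc j) r)) (ℚP.*-zeroˡ (pow[x-1] 0 r)) ⟩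
  0ℚ + sumℚ N (λ j → p j * pow[x-1] (suc j) r)                           ≡⟨ ℚP.+-identityˡ _ ⟩
  sumℚ N (λ j → p j * pow[x-1] (suc j) r)                                ≡⟨ sumℚ-cong N (λ j _ → cong (p j *_) (pow[x-1]-suc j r)) ⟩
  sumℚ N (λ j → p j * (mulX (pow[x-1] j) r - pow[x-1] j r))            ≡⟨ sumℚ-cong N (λ j _ → ℚP.*-distribˡ-+ (p j) _ _) ⟩
  sumℚ N (λ j → p j * mulX (pow[x-1] j) r + p j * - pow[x-1] j r)       ≡⟨ sumℚ-cong N (λ j _ → cong (λ x → p j * mulX (pow[x-1] j) r + x) (sym (ℚP.neg-distribʳ-* (p j) _))) ⟩
  sumℚ N (λ j → p j * mulX (pow[x-1] j) r - p j * pow[x-1] j r)         ≡⟨ sumℚ-sub N (λ j → p j * mulX (pow[x-1] j) r) (λ j → p j * pow[x-1] j r) ⟩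
  sumℚ N (λ j → p j * mulX (pow[x-1] j) r) - atPred N p r               ≡⟨ cong (_- atPred N p r) (coefficientwise r) ⟩
  mulX (atPred N p) r - atPred N p r                                     ∎
  where
  open ≡-Reasoning
  coefficientwise : ∀ r → sumℚ N (λ j → p j * mulX (pow[x-1] j) r) ≡ mulX (atPred N p) r
  coefficientwise zero    = sumℚ-zero N (λ j _ → ℚP.*-zeroʳ (p j))
  coefficientwise (suc r) = refl

atPred-extend : ∀ {N M} (p : ℕ → ℚ) r → VanishesFrom p N → N ≤ M → atPred M p r ≡ atPred N p r
atPred-extend {N} {M} p r p≥N≡0 N≤M = begin
  atPred M p r                  ≡⟨ cong (λ K → atPred K p r) (sym (ℕP.m+[n∸m]≡n N≤M)) ⟩
  atPred (N ℕ.+ (M ∸ N)) p r    ≡⟨ sumℚ-high-zero N (M ∸ N) (λ i → trans (cong (_* pow[x-1] (N ℕ.+ i) r) (p≥N≡0 (N ℕ.+ i) (ℕP.m≤m+n N i))) (ℚP.*-zeroˡ (pow[x-1] (N ℕ.+ i) r))) ⟩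
  atPred N p r                  ∎
  where open ≡-Reasoning

atPred-from : ∀ r N (p : ℕ → ℚ) → atPred (r ℕ.+ N) p r ≡ sumℚ N (λ i → p (r ℕ.+ i) * pow[x-1] (r ℕ.+ i) r)
atPred-from r N p = sumℚ-low-zero r N (λ j j<r → trans (cong (p j *_) (pow[x-1]-vanish j<r)) (ℚP.*-zeroʳ (p j)))

∇-sub : ∀ N (p q : ℕ → ℚ) r → ∇ N (λ j → p j - q j) r ≡ ∇ N p r - ∇ N q r
∇-sub N p q r = trans (cong (λ x → p r - q r - x) (atPred-sub N p q r))
  (solve 4 (λ a b A B → a :- b :- (A :- B) := a :- A :- (b :- B)) refl (p r) (q r) (atPred N p r) (atPred N q r))
  where open ℚSolver

∇-at-top : ∀ {N} (p : ℕ → ℚ) r → VanishesFrom p (2 ℕ.+ r) → 2 ℕ.+ r ≤ N → ∇ N p r ≡ ℕ→ℚ (suc r) * p (suc r)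
∇-at-top {N} p r p≥2+r≡0 2+r≤N = begin
  p r - atPred N p r                                            ≡⟨ cong (λ x → p r - x) (atPred-extend p r p≥2+r≡0 2+r≤N) ⟩
  p r - (sumℚ r f + f r + f (suc r))                            ≡⟨ cong (λ x → p r - (x + f r + f (suc r))) (sumℚ-zero r (λ j j<r → trans (cong (p j *_) (pow[x-1]-vanish j<r)) (ℚP.*-zeroʳ (p j)))) ⟩
  p r - (0ℚ + f r + f (suc r))                                  ≡⟨ cong₂ (λ x y → p r - (0ℚ + p r * x + p (suc r) * y)) (pow[x-1]-diag r) (pow[x-1]-sub-diag r) ⟩
  p r - (0ℚ + p r * 1ℚ + p (suc r) * - ℕ→ℚ (suc r))             ≡⟨ solve 3 (λ a b c → a :- (con 0ℚ :+ a :* con 1ℚ :+ b :* (:- c)) := c :* b) refl (p r) (p (suc r)) (ℕ→ℚ (suc r)) ⟩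
  ℕ→ℚ (suc r) * p (suc r)                                       ∎
  where
  open ≡-Reasoning
  open ℚSolver
  f : ℕ → ℚ
  f j = p j * pow[x-1] j r

[1+n]*x≡0⇒x≡0 : ∀ n {x} → ℕ→ℚ (suc n) * x ≡ 0ℚ → x ≡ 0ℚ
[1+n]*x≡0⇒x≡0 n {x} [1+n]x≡0 = begin
  x                                 ≡⟨ sym (ℚP.*-identityˡ x) ⟩
  1ℚ * x                            ≡⟨ cong (_* x) (sym (1/suc-inverse n)) ⟩
  1/suc n * ℕ→ℚ (suc n) * x         ≡⟨ ℚP.*-assoc (1/suc n) (ℕ→ℚ (suc n)) x ⟩
  1/suc n * (ℕ→ℚ (suc n) * x)       ≡⟨ cong (1/suc n *_) [1+n]x≡0 ⟩
  1/suc n * 0ℚ                      ≡⟨ ℚP.*-zeroʳ (1/suc n) ⟩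
  0ℚ                                ∎
  where open ≡-Reasoning

∇-zero-step : ∀ {N} (p : ℕ → ℚ) r → VanishesFrom p (2 ℕ.+ r) → 2 ℕ.+ r ≤ N → ∇ N p r ≡ 0ℚ → VanishesFrom p (suc r)
∇-zero-step p r p≥2+r≡0 2+r≤N ∇p≡0 j 1+r≤j with ℕP.m≤n⇒m<n∨m≡n 1+r≤j
... | inj₁ 2+r≤j = p≥2+r≡0 j 2+r≤j
... | inj₂ refl  = [1+n]*x≡0⇒x≡0 r (trans (sym (∇-at-top p r p≥2+r≡0 2+r≤N)) ∇p≡0)

-- p(x) = p(x - 1) forces p to be constant.
∇-zero⇒constant : ∀ m (p : ℕ → ℚ) → (∀ r → r ≤ m → ∇ (2 ℕ.+ m) p r ≡ 0ℚ) → VanishesFrom p (2 ℕ.+ m) → VanishesFrom p 1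
∇-zero⇒constant m p ∇p≡0 p≥2+m≡0 = descend m 0 refl
  where
  step : ∀ r → r ≤ m → VanishesFrom p (2 ℕ.+ r) → VanishesFrom p (suc r)
  step r r≤m p≥2+r≡0 = ∇-zero-step p r p≥2+r≡0 (s≤s (s≤s r≤m)) (∇p≡0 r r≤m)
  descend : ∀ t r → r ℕ.+ t ≡ m → VanishesFrom p (suc r)
  descend zero    r r+0≡m = step r (subst (r ≤_) r+0≡m (ℕP.m≤m+n r 0))
    (subst (λ k → VanishesFrom p (2 ℕ.+ k)) (trans (sym r+0≡m) (ℕP.+-identityʳ r)) p≥2+m≡0)
  descend (suc t) r r+1+t≡m = step r (subst (r ≤_) r+1+t≡m (ℕP.m≤m+n r (suc t)))
    (descend t (suc r) (trans (sym (ℕP.+-suc r t)) r+1+t≡m))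

-- Power sums through Stirling numbers

-- The coefficients of (x + 1) x (x - 1) ⋯ (x - l + 1).
σ⁺ : ℕ → ℕ → ℚ
σ⁺ l j = s₁ l j + mulX (s₁ l) j

σ⁺-vanish : ∀ l → VanishesFrom (σ⁺ l) (2 ℕ.+ l)
σ⁺-vanish l (suc j) (s≤s l<j) = trans (cong₂ _+_ (s₁-vanish (ℕP.m<n⇒m<1+n l<j)) (s₁-vanish l<j)) (ℚP.+-identityˡ 0ℚ)

σ⁺-suc : ∀ l j → σ⁺ (suc l) j ≡ mulX (σ⁺ l) j - ℕ→ℚ l * σ⁺ l j
σ⁺-suc l zero    = trans (cong (_+ 0ℚ) (s₁-suc l 0))
  (solve 2 (λ L s → (con 0ℚ :- L :* s) :+ con 0ℚ := con 0ℚ :- L :* (s :+ con 0ℚ)) refl (ℕ→ℚ l) (s₁ l 0))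
  where open ℚSolver
σ⁺-suc l (suc j) = trans (cong₂ _+_ (s₁-suc l (suc j)) (s₁-suc l j))
  (solve 4 (λ a b M L → (a :- L :* b) :+ (M :- L :* a) := (a :+ M) :- L :* (b :+ a)) refl
    (s₁ l j) (s₁ l (suc j)) (mulX (s₁ l) j) (ℕ→ℚ l))
  where open ℚSolver

σ⁺-sub-s₁-suc : ∀ l r → σ⁺ l r - s₁ (suc l) r ≡ ℕ→ℚ (suc l) * s₁ l r
σ⁺-sub-s₁-suc l r = begin
  σ⁺ l r - s₁ (suc l) r                                 ≡⟨ cong (λ x → σ⁺ l r - x) (s₁-suc l r) ⟩
  s₁ l r + mulX (s₁ l) r - (mulX (s₁ l) r - ℕ→ℚ l * s₁ l r)  ≡⟨ solve 3 (λ s M L → s :+ M :- (M :- L :* s) := (con 1ℚ :+ L) :* s) refl (s₁ l r) (mulX (s₁ l) r) (ℕ→ℚ l) ⟩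
  (1ℚ + ℕ→ℚ l) * s₁ l r                                  ≡⟨ cong (_* s₁ l r) (sym (ℕ→ℚ-suc l)) ⟩
  ℕ→ℚ (suc l) * s₁ l r                                   ∎
  where open ≡-Reasoning; open ℚSolver

-- (x + 1)^(l+1) evaluated at x - 1 is x^(l+1) (falling factorial powers)
atPred-σ⁺ : ∀ l r → atPred (2 ℕ.+ l) (σ⁺ l) r ≡ s₁ (suc l) r
atPred-σ⁺ zero    zero          = refl
atPred-σ⁺ zero    (suc zero)    = refl
atPred-σ⁺ zero    (suc (suc r)) = refl
atPred-σ⁺ (suc l) r = begin
  atPred (3 ℕ.+ l) (σ⁺ (suc l)) r
    ≡⟨ atPred-cong (3 ℕ.+ l) r (σ⁺-suc l) ⟩
  atPred (3 ℕ.+ l) (λ j → mulX (σ⁺ l) j - ℕ→ℚ l * σ⁺ l j) r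
    ≡⟨ atPred-sub (3 ℕ.+ l) (mulX (σ⁺ l)) (λ j → ℕ→ℚ l * σ⁺ l j) r ⟩
  atPred (3 ℕ.+ l) (mulX (σ⁺ l)) r - atPred (3 ℕ.+ l) (λ j → ℕ→ℚ l * σ⁺ l j) r
    ≡⟨ cong₂ _-_ (atPred-mulX (2 ℕ.+ l) (σ⁺ l) r) (atPred-*ˡ (3 ℕ.+ l) (ℕ→ℚ l) (σ⁺ l) r) ⟩
  mulX (atPred (2 ℕ.+ l) (σ⁺ l)) r - atPred (2 ℕ.+ l) (σ⁺ l) r - ℕ→ℚ l * atPred (3 ℕ.+ l) (σ⁺ l) r
    ≡⟨ cong (λ x → mulX (atPred (2 ℕ.+ l) (σ⁺ l)) r - atPred (2 ℕ.+ l) (σ⁺ l) r - ℕ→ℚ l * x)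
         (atPred-extend (σ⁺ l) r (σ⁺-vanish l) (ℕP.n≤1+n (2 ℕ.+ l))) ⟩
  mulX (atPred (2 ℕ.+ l) (σ⁺ l)) r - atPred (2 ℕ.+ l) (σ⁺ l) r - ℕ→ℚ l * atPred (2 ℕ.+ l) (σ⁺ l) r
    ≡⟨ cong₂ (λ x y → x - y - ℕ→ℚ l * y) (mulX-atPred-σ⁺ r) (atPred-σ⁺ l r) ⟩
  mulX (s₁ (suc l)) r - s₁ (suc l) r - ℕ→ℚ l * s₁ (suc l) r
    ≡⟨ solve 3 (λ M s L → M :- s :- L :* s := M :- (con 1ℚ :+ L) :* s) refl (mulX (s₁ (suc l)) r) (s₁ (suc l) r) (ℕ→ℚ l) ⟩
  mulX (s₁ (suc l)) r - (1ℚ + ℕ→ℚ l) * s₁ (suc l) r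
    ≡⟨ cong (λ x → mulX (s₁ (suc l)) r - x * s₁ (suc l) r) (sym (ℕ→ℚ-suc l)) ⟩
  mulX (s₁ (suc l)) r - ℕ→ℚ (suc l) * s₁ (suc l) r
    ≡⟨ sym (s₁-suc (suc l) r) ⟩
  s₁ (2 ℕ.+ l) r ∎
  where
  open ≡-Reasoning
  open ℚSolver
  mulX-atPred-σ⁺ : ∀ r → mulX (atPred (2 ℕ.+ l) (σ⁺ l)) r ≡ mulX (s₁ (suc l)) r
  mulX-atPred-σ⁺ zero    = refl
  mulX-atPred-σ⁺ (suc r) = atPred-σ⁺ l r

-- The coefficients of Σ_{0 ≤ i ≤ x} i^m, since x^m = Σ_l S(m,l) x(x-1)⋯(x-l+1)
powerSum-stirling : ℕ → ℕ → ℚ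
powerSum-stirling m j = sumℚ (suc m) (λ l → S₂ m l * (1/suc l * σ⁺ l j))

powerSum-stirling-vanish : ∀ m → VanishesFrom (powerSum-stirling m) (2 ℕ.+ m)
powerSum-stirling-vanish m j 2+m≤j = sumℚ-zero (suc m) λ l l≤m →
  trans (cong (λ x → S₂ m l * (1/suc l * x)) (σ⁺-vanish l j (ℕP.≤-trans (s≤s l≤m) 2+m≤j)))
        (trans (cong (S₂ m l *_) (ℚP.*-zeroʳ (1/suc l))) (ℚP.*-zeroʳ (S₂ m l)))

∇-powerSum-stirling : ∀ m r → ∇ (2 ℕ.+ m) (powerSum-stirling m) r ≡ δ m r
∇-powerSum-stirling m r = begin
  powerSum-stirling m r - atPred (2 ℕ.+ m) (powerSum-stirling m) r
    ≡⟨ cong (λ x → powerSum-stirling m r - x) (atPred-sumℚ (2 ℕ.+ m) (suc m) (λ l j → S₂ m l * (1/suc l * σ⁺ l j)) r) ⟩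
  powerSum-stirling m r - sumℚ (suc m) (λ l → atPred (2 ℕ.+ m) (λ j → S₂ m l * (1/suc l * σ⁺ l j)) r)
    ≡⟨ cong (λ x → powerSum-stirling m r - x) (sumℚ-cong (suc m) (λ l l≤m → shifted l (ℕP.≤-pred l≤m))) ⟩
  powerSum-stirling m r - sumℚ (suc m) (λ l → S₂ m l * (1/suc l * s₁ (suc l) r))
    ≡⟨ sym (sumℚ-sub (suc m) (λ l → S₂ m l * (1/suc l * σ⁺ l r)) (λ l → S₂ m l * (1/suc l * s₁ (suc l) r))) ⟩
  sumℚ (suc m) (λ l → S₂ m l * (1/suc l * σ⁺ l r) - S₂ m l * (1/suc l * s₁ (suc l) r))
    ≡⟨ sumℚ-cong (suc m) (λ l _ → difference l) ⟩
  sumℚ (suc m) (λ l → S₂ m l * s₁ l r)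
    ≡⟨ S₂-s₁-orthogonal m r ⟩
  δ m r ∎
  where
  open ≡-Reasoning
  open ℚSolver
  shifted : ∀ l → l ≤ m → atPred (2 ℕ.+ m) (λ j → S₂ m l * (1/suc l * σ⁺ l j)) r ≡ S₂ m l * (1/suc l * s₁ (suc l) r)
  shifted l l≤m = begin
    atPred (2 ℕ.+ m) (λ j → S₂ m l * (1/suc l * σ⁺ l j)) r   ≡⟨ atPred-*ˡ (2 ℕ.+ m) (S₂ m l) (λ j → 1/suc l * σ⁺ l j) r ⟩
    S₂ m l * atPred (2 ℕ.+ m) (λ j → 1/suc l * σ⁺ l j) r     ≡⟨ cong (S₂ m l *_) (atPred-*ˡ (2 ℕ.+ m) (1/suc l) (σ⁺ l) r) ⟩
    S₂ m l * (1/suc l * atPred (2 ℕ.+ m) (σ⁺ l) r)           ≡⟨ cong (λ x → S₂ m l * (1/suc l * x)) (atPred-extend (σ⁺ l) r (σ⁺-vanish l) (s≤s (s≤s l≤m))) ⟩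
    S₂ m l * (1/suc l * atPred (2 ℕ.+ l) (σ⁺ l) r)           ≡⟨ cong (λ x → S₂ m l * (1/suc l * x)) (atPred-σ⁺ l r) ⟩
    S₂ m l * (1/suc l * s₁ (suc l) r)                         ∎
  difference : ∀ l → S₂ m l * (1/suc l * σ⁺ l r) - S₂ m l * (1/suc l * s₁ (suc l) r) ≡ S₂ m l * s₁ l r
  difference l = begin
    S₂ m l * (1/suc l * σ⁺ l r) - S₂ m l * (1/suc l * s₁ (suc l) r)
      ≡⟨ solve 4 (λ S h a b → S :* (h :* a) :- S :* (h :* b) := S :* (h :* (a :- b))) refl (S₂ m l) (1/suc l) (σ⁺ l r) (s₁ (suc l) r) ⟩
    S₂ m l * (1/suc l * (σ⁺ l r - s₁ (suc l) r))
      ≡⟨ cong (λ x → S₂ m l * (1/suc l * x)) (σ⁺-sub-s₁-suc l r) ⟩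
    S₂ m l * (1/suc l * (ℕ→ℚ (suc l) * s₁ l r))
      ≡⟨ cong (S₂ m l *_) (sym (ℚP.*-assoc (1/suc l) (ℕ→ℚ (suc l)) (s₁ l r))) ⟩
    S₂ m l * (1/suc l * ℕ→ℚ (suc l) * s₁ l r)
      ≡⟨ cong (λ x → S₂ m l * (x * s₁ l r)) (1/suc-inverse l) ⟩
    S₂ m l * (1ℚ * s₁ l r)
      ≡⟨ cong (S₂ m l *_) (ℚP.*-identityˡ (s₁ l r)) ⟩
    S₂ m l * s₁ l r ∎

-- Bernoulli numbers

lookupℚ : List ℚ → ℕ → ℚ
lookupℚ []       _       = 0ℚ
lookupℚ (x ∷ xs) zero    = x
lookupℚ (x ∷ xs) (suc i) = lookupℚ xs i

lookupℚ-++ˡ : ∀ xs ys {i} → i < length xs → lookupℚ (xs ++ ys) i ≡ lookupℚ xs i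
lookupℚ-++ˡ (x ∷ xs) ys {zero}  _         = refl
lookupℚ-++ˡ (x ∷ xs) ys {suc i} (s≤s i<n) = lookupℚ-++ˡ xs ys i<n

lookupℚ-snoc : ∀ xs {y i} → length xs ≡ i → lookupℚ (xs ++ y ∷ []) i ≡ y
lookupℚ-snoc []       refl = refl
lookupℚ-snoc (x ∷ xs) refl = lookupℚ-snoc xs refl

bernoulliList-∷ : ∀ n → ∃₂ λ x xs → bernoulliList (suc n) ≡ x ∷ xs
bernoulliList-∷ zero = _ , _ , refl
bernoulliList-∷ (suc n) with bernoulliList (suc n) | bernoulliList-∷ n
... | .(x ∷ xs) | x , xs , refl = _ , _ , refl

length-bernoulliList : ∀ n → length (bernoulliList n) ≡ n
length-bernoulliList zero    = refl
length-bernoulliList (suc n) = trans (length-++ (bernoulliList n))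
  (trans (ℕP.+-comm (length (bernoulliList n)) 1) (cong suc (length-bernoulliList n)))

lookupℚ-drop-1 : ∀ xs i → lookupℚ (drop 1 xs) i ≡ lookupℚ xs (suc i)
lookupℚ-drop-1 []       i = refl
lookupℚ-drop-1 (x ∷ xs) i = refl

-- Defs keeps the step of bernoulliList and its list lookups private (the one in
-- bernoulli is local to it), so these three are solved by unification against them.
-- In bernoulli-suc-lookup, `with suc n` separates the parameter of the local lookup
-- from its index, which turns that unification problem into a pattern.
mutual
  bernoulliStep : ℕ → List ℚ → ℚ
  bernoulliStep = _

  listLookup : List ℚ → ℕ → ℚ
  listLookup = _

  bernoulliLookup : ℕ → List ℚ → ℕ → ℚ
  bernoulliLookup = _

  bernoulliList-suc : ∀ n → bernoulliList (suc n) ≡ bernoulliList n ++ bernoulliStep n (bernoulliList n) ∷ []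
  bernoulliList-suc n with bernoulliList n
  ... | bs = refl

  bernoulliStep-suc : ∀ k bs → bernoulliStep (suc k) bs
                    ≡ - (1/suc (suc k) * sumℚ (suc k) (λ j → ℕ→ℚ (suc (suc k) C j) * listLookup bs j))
  bernoulliStep-suc k bs = refl

  bernoulli-suc-lookup : ∀ n → bernoulli (suc n) ≡ bernoulliLookup (suc n) (drop 1 (bernoulliList (suc (suc n)))) n
  bernoulli-suc-lookup n with bernoulliList (suc (suc n)) | bernoulliList-∷ (suc n)
  ... | .(x ∷ xs) | x , xs , refl with suc n
  ... | p = refl

listLookup≗lookupℚ : ∀ xs i → listLookup xs i ≡ lookupℚ xs i
listLookup≗lookupℚ []       i       = refl
listLookup≗lookupℚ (x ∷ xs) zero    = refl
listLookup≗lookupℚ (x ∷ xs) (suc i) = listLookup≗lookupℚ xs i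

bernoulliLookup≗lookupℚ : ∀ p xs i → bernoulliLookup p xs i ≡ lookupℚ xs i
bernoulliLookup≗lookupℚ p []       i       = refl
bernoulliLookup≗lookupℚ p (x ∷ xs) zero    = refl
bernoulliLookup≗lookupℚ p (x ∷ xs) (suc i) = bernoulliLookup≗lookupℚ p xs i

bernoulli-lookup : ∀ n → bernoulli n ≡ lookupℚ (bernoulliList (suc n)) n
bernoulli-lookup zero    = refl
bernoulli-lookup (suc n) = trans (bernoulli-suc-lookup n)
  (trans (bernoulliLookup≗lookupℚ (suc n) (drop 1 (bernoulliList (suc (suc n)))) n)
         (lookupℚ-drop-1 (bernoulliList (suc (suc n))) n))

lookupℚ-bernoulliList : ∀ n {j} → j < n → lookupℚ (bernoulliList n) j ≡ bernoulli j
lookupℚ-bernoulliList (suc n) {j} j<1+n with ℕP.m≤n⇒m<n∨m≡n (ℕP.≤-pred j<1+n)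
... | inj₁ j<n = begin
  lookupℚ (bernoulliList (suc n)) j                                       ≡⟨ cong (λ bs → lookupℚ bs j) (bernoulliList-suc n) ⟩
  lookupℚ (bernoulliList n ++ bernoulliStep n (bernoulliList n) ∷ []) j   ≡⟨ lookupℚ-++ˡ (bernoulliList n) _ (subst (j <_) (sym (length-bernoulliList n)) j<n) ⟩
  lookupℚ (bernoulliList n) j                                             ≡⟨ lookupℚ-bernoulliList n j<n ⟩
  bernoulli j                                                             ∎
  where open ≡-Reasoning
... | inj₂ refl = sym (bernoulli-lookup j)

bernoulli-suc : ∀ k → bernoulli (suc k) ≡ - (1/suc (suc k) * sumℚ (suc k) (λ j → ℕ→ℚ (suc (suc k) C j) * bernoulli j))
bernoulli-suc k = begin
  bernoulli (suc k)                                                        ≡⟨ bernoulli-lookup (suc k) ⟩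
  lookupℚ (bernoulliList (suc (suc k))) (suc k)                            ≡⟨ cong (λ bs → lookupℚ bs (suc k)) (bernoulliList-suc (suc k)) ⟩
  lookupℚ (bs ++ bernoulliStep (suc k) bs ∷ []) (suc k)                    ≡⟨ lookupℚ-snoc bs (length-bernoulliList (suc k)) ⟩
  bernoulliStep (suc k) bs                                                 ≡⟨ bernoulliStep-suc k bs ⟩
  - (1/suc (suc k) * sumℚ (suc k) (λ j → ℕ→ℚ (suc (suc k) C j) * listLookup bs j))
    ≡⟨ cong (λ Σ → - (1/suc (suc k) * Σ)) (sumℚ-cong (suc k) λ j j<1+k → cong (ℕ→ℚ (suc (suc k) C j) *_)
         (trans (listLookup≗lookupℚ bs j) (lookupℚ-bernoulliList (suc k) j<1+k))) ⟩
  - (1/suc (suc k) * sumℚ (suc k) (λ j → ℕ→ℚ (suc (suc k) C j) * bernoulli j)) ∎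
  where
  open ≡-Reasoning
  bs = bernoulliList (suc k)

bernoulli-binomial-sum : ∀ n → sumℚ (suc n) (λ i → ℕ→ℚ (suc n C i) * bernoulli i) ≡ δ n 0
bernoulli-binomial-sum zero    = refl
bernoulli-binomial-sum (suc k) = begin
  X + ℕ→ℚ (suc (suc k) C suc k) * bernoulli (suc k)          ≡⟨ cong₂ (λ c b → X + ℕ→ℚ c * b) (trans (sym (C-+-sym 1 (suc k))) (nC1≡n (suc (suc k)))) (bernoulli-suc k) ⟩
  X + ℕ→ℚ (suc (suc k)) * - (1/suc (suc k) * X)              ≡⟨ solve 3 (λ x c h → x :+ c :* (:- (h :* x)) := x :- (h :* c) :* x) refl X (ℕ→ℚ (suc (suc k))) (1/suc (suc k)) ⟩
  X - 1/suc (suc k) * ℕ→ℚ (suc (suc k)) * X                   ≡⟨ cong (λ z → X - z * X) (1/suc-inverse (suc k)) ⟩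
  X - 1ℚ * X                                                  ≡⟨ solve 1 (λ x → x :- con 1ℚ :* x := con 0ℚ) refl X ⟩
  0ℚ                                                          ∎
  where
  open ≡-Reasoning
  open ℚSolver
  X = sumℚ (suc k) (λ j → ℕ→ℚ (suc (suc k) C j) * bernoulli j)

bernoulli-binomial-sum-reversed : ∀ n → sumℚ (suc n) (λ p → ℕ→ℚ (suc n C suc p) * bernoulli (n ∸ p)) ≡ δ n 0
bernoulli-binomial-sum-reversed n = begin
  sumℚ (suc n) (λ p → ℕ→ℚ (suc n C suc p) * bernoulli (n ∸ p))              ≡⟨ sumℚ-reverse (suc n) _ ⟩
  sumℚ (suc n) (λ i → ℕ→ℚ (suc n C suc (n ∸ i)) * bernoulli (n ∸ (n ∸ i)))  ≡⟨ sumℚ-cong (suc n) (λ i i<1+n → reflect i (ℕP.≤-pred i<1+n)) ⟩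
  sumℚ (suc n) (λ i → ℕ→ℚ (suc n C i) * bernoulli i)                         ≡⟨ bernoulli-binomial-sum n ⟩
  δ n 0                                                                        ∎
  where
  open ≡-Reasoning
  reflect : ∀ i → i ≤ n → ℕ→ℚ (suc n C suc (n ∸ i)) * bernoulli (n ∸ (n ∸ i)) ≡ ℕ→ℚ (suc n C i) * bernoulli i
  reflect i i≤n = cong₂ (λ c j → ℕ→ℚ c * bernoulli j) (sym (trans (nCk≡nC[n∸k] (ℕP.m≤n⇒m≤1+n i≤n)) (cong (suc n C_) (ℕP.+-∸-assoc 1 i≤n)))) (ℕP.m∸[m∸n]≡n i≤n)

-- Power sums through Bernoulli numbers

C-trinomial-shifted : ∀ r n p → p ≤ n →
  (suc (r ℕ.+ n) C suc (r ℕ.+ p)) ℕ.* (suc (r ℕ.+ p) C r) ≡ (suc (r ℕ.+ n) C r) ℕ.* (suc n C suc p)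
C-trinomial-shifted r n p p≤n =
  subst (λ n → (suc (r ℕ.+ n) C suc (r ℕ.+ p)) ℕ.* (suc (r ℕ.+ p) C r) ≡ (suc (r ℕ.+ n) C r) ℕ.* (suc n C suc p))
        (ℕP.m+[n∸m]≡n p≤n) (split-at-p (n ∸ p))
  where
  open ≡-Reasoning
  r+1+p : r ℕ.+ suc p ≡ suc (r ℕ.+ p)
  r+1+p = ℕP.+-suc r p
  split-at-p : ∀ q → (suc (r ℕ.+ (p ℕ.+ q)) C suc (r ℕ.+ p)) ℕ.* (suc (r ℕ.+ p) C r)
                   ≡ (suc (r ℕ.+ (p ℕ.+ q)) C r) ℕ.* (suc (p ℕ.+ q) C suc p)
  split-at-p q = begin
    (suc (r ℕ.+ (p ℕ.+ q)) C suc (r ℕ.+ p)) ℕ.* (suc (r ℕ.+ p) C r)   ≡⟨ cong₂ (λ a b → (a C b) ℕ.* (b C r)) r+1+p+q r+1+p ⟨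
    ((r ℕ.+ suc p ℕ.+ q) C (r ℕ.+ suc p)) ℕ.* ((r ℕ.+ suc p) C r)       ≡⟨ C-trinomial r (suc p) q ⟩
    ((r ℕ.+ suc p ℕ.+ q) C r) ℕ.* (suc (p ℕ.+ q) C suc p)                ≡⟨ cong (ℕ._* (suc (p ℕ.+ q) C suc p)) (cong (_C r) r+1+p+q) ⟩
    (suc (r ℕ.+ (p ℕ.+ q)) C r) ℕ.* (suc (p ℕ.+ q) C suc p)            ∎
    where
    r+1+p+q : r ℕ.+ suc p ℕ.+ q ≡ suc (r ℕ.+ (p ℕ.+ q))
    r+1+p+q = trans (cong (ℕ._+ q) r+1+p) (cong suc (ℕP.+-assoc r p q))

-- The coefficients of Σ_{0 ≤ i ≤ x} i^m given by Faulhaber's formula, except for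
-- the constant term, which ∇ does not see.
powerSum-bernoulli : ℕ → ℕ → ℚ
powerSum-bernoulli m zero    = 0ℚ
powerSum-bernoulli m (suc i) = signℚ (m ∸ i) * (1/suc m * (ℕ→ℚ (suc m C suc i) * bernoulli (m ∸ i)))

powerSum-bernoulli-vanish : ∀ m → VanishesFrom (powerSum-bernoulli m) (2 ℕ.+ m)
powerSum-bernoulli-vanish m (suc i) (s≤s 1+m≤i) = begin
  signℚ (m ∸ i) * (1/suc m * (ℕ→ℚ (suc m C suc i) * bernoulli (m ∸ i)))  ≡⟨ cong (λ c → signℚ (m ∸ i) * (1/suc m * (ℕ→ℚ c * bernoulli (m ∸ i)))) (k>n⇒nCk≡0 (s≤s 1+m≤i)) ⟩
  signℚ (m ∸ i) * (1/suc m * (0ℚ * bernoulli (m ∸ i)))                    ≡⟨ solve 3 (λ s h b → s :* (h :* (con 0ℚ :* b)) := con 0ℚ) refl (signℚ (m ∸ i)) (1/suc m) (bernoulli (m ∸ i)) ⟩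
  0ℚ                                                                       ∎
  where open ≡-Reasoning; open ℚSolver

powerSum-bernoulli-term : ∀ r n p → p ≤ n →
  powerSum-bernoulli (r ℕ.+ n) (suc (r ℕ.+ p)) * pow[x-1] (suc (r ℕ.+ p)) r
  ≡ signℚ (suc n) * (1/suc (r ℕ.+ n) * ℕ→ℚ (suc (r ℕ.+ n) C r)) * (ℕ→ℚ (suc n C suc p) * bernoulli (n ∸ p))
powerSum-bernoulli-term r n p p≤n = begin
  signℚ (m ∸ (r ℕ.+ p)) * (h * (C₁ * bernoulli (m ∸ (r ℕ.+ p)))) * (C₂ * signℚ (suc (r ℕ.+ p) ∸ r))
    ≡⟨ cong₂ (λ e f → signℚ e * (h * (C₁ * bernoulli e)) * (C₂ * signℚ f)) (ℕP.[m+n]∸[m+o]≡n∸o r n p) (trans (cong (_∸ r) (sym (ℕP.+-suc r p))) (ℕP.m+n∸m≡n r (suc p))) ⟩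
  signℚ (n ∸ p) * (h * (C₁ * bernoulli (n ∸ p))) * (C₂ * signℚ (suc p))
    ≡⟨ solve 6 (λ s₁ h c₁ b c₂ s₂ → s₁ :* (h :* (c₁ :* b)) :* (c₂ :* s₂) := (s₁ :* s₂) :* (h :* ((c₁ :* c₂) :* b))) refl
         (signℚ (n ∸ p)) h C₁ (bernoulli (n ∸ p)) C₂ (signℚ (suc p)) ⟩
  (signℚ (n ∸ p) * signℚ (suc p)) * (h * ((C₁ * C₂) * bernoulli (n ∸ p)))
    ≡⟨ cong₂ (λ x y → x * (h * (y * bernoulli (n ∸ p)))) signs binomials ⟩
  signℚ (suc n) * (h * ((ℕ→ℚ (suc m C r) * ℕ→ℚ (suc n C suc p)) * bernoulli (n ∸ p)))
    ≡⟨ solve 5 (λ s h a c b → s :* (h :* ((a :* c) :* b)) := s :* (h :* a) :* (c :* b)) refl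
         (signℚ (suc n)) h (ℕ→ℚ (suc m C r)) (ℕ→ℚ (suc n C suc p)) (bernoulli (n ∸ p)) ⟩
  signℚ (suc n) * (h * ℕ→ℚ (suc m C r)) * (ℕ→ℚ (suc n C suc p) * bernoulli (n ∸ p)) ∎
  where
  open ≡-Reasoning
  open ℚSolver
  m = r ℕ.+ n
  h = 1/suc m
  C₁ = ℕ→ℚ (suc m C suc (r ℕ.+ p))
  C₂ = ℕ→ℚ (suc (r ℕ.+ p) C r)
  signs : signℚ (n ∸ p) * signℚ (suc p) ≡ signℚ (suc n)
  signs = trans (sym (signℚ-+ (n ∸ p) (suc p))) (cong signℚ (trans (ℕP.+-suc (n ∸ p) p) (cong suc (ℕP.m∸n+n≡m p≤n))))
  binomials : C₁ * C₂ ≡ ℕ→ℚ (suc m C r) * ℕ→ℚ (suc n C suc p)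
  binomials = trans (sym (ℕ→ℚ-* (suc m C suc (r ℕ.+ p)) _))
    (trans (cong ℕ→ℚ (C-trinomial-shifted r n p p≤n)) (ℕ→ℚ-* (suc m C r) (suc n C suc p)))

δ-+ : ∀ r n → δ (r ℕ.+ n) r ≡ δ n 0
δ-+ zero    n = refl
δ-+ (suc r) n = δ-+ r n

∇-powerSum-bernoulli : ∀ m r → r ≤ m → ∇ (2 ℕ.+ m) (powerSum-bernoulli m) r ≡ δ m r
∇-powerSum-bernoulli m r r≤m = subst (λ m → ∇ (2 ℕ.+ m) (powerSum-bernoulli m) r ≡ δ m r) (ℕP.m+[n∸m]≡n r≤m) (above-r (m ∸ r))
  where
  above-r : ∀ n → ∇ (2 ℕ.+ (r ℕ.+ n)) (powerSum-bernoulli (r ℕ.+ n)) r ≡ δ (r ℕ.+ n) r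
  above-r n = begin
    b r - atPred (2 ℕ.+ (r ℕ.+ n)) b r
      ≡⟨ cong (λ N → b r - atPred N b r) (sym (trans (ℕP.+-suc r (suc n)) (cong suc (ℕP.+-suc r n)))) ⟩
    b r - atPred (r ℕ.+ (2 ℕ.+ n)) b r
      ≡⟨ cong (λ x → b r - x) (atPred-from r (2 ℕ.+ n) b) ⟩
    b r - sumℚ (2 ℕ.+ n) (λ i → b (r ℕ.+ i) * pow[x-1] (r ℕ.+ i) r)
      ≡⟨ cong (λ x → b r - x) (sumℚ-suc-head (suc n) (λ i → b (r ℕ.+ i) * pow[x-1] (r ℕ.+ i) r)) ⟩
    b r - (b (r ℕ.+ 0) * pow[x-1] (r ℕ.+ 0) r + sumℚ (suc n) (λ p → b (r ℕ.+ suc p) * pow[x-1] (r ℕ.+ suc p) r))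
      ≡⟨ cong₂ (λ x y → b r - (x + y)) diagonal (sumℚ-cong (suc n) (λ p p<1+n → term p (ℕP.≤-pred p<1+n))) ⟩
    b r - (b r + sumℚ (suc n) (λ p → K * G p))
      ≡⟨ cong (λ x → b r - (b r + x)) (sym (sumℚ-*ˡ (suc n) K G)) ⟩
    b r - (b r + K * sumℚ (suc n) G)
      ≡⟨ cong (λ x → b r - (b r + K * x)) (bernoulli-binomial-sum-reversed n) ⟩
    b r - (b r + K * δ n 0)
      ≡⟨ solve 2 (λ x y → x :- (x :+ y) := :- y) refl (b r) (K * δ n 0) ⟩
    - (K * δ n 0)
      ≡⟨ leading n ⟩
    δ n 0
      ≡⟨ sym (δ-+ r n) ⟩
    δ (r ℕ.+ n) r ∎
    where
    open ≡-Reasoning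
    open ℚSolver
    b = powerSum-bernoulli (r ℕ.+ n)
    K = signℚ (suc n) * (1/suc (r ℕ.+ n) * ℕ→ℚ (suc (r ℕ.+ n) C r))
    G : ℕ → ℚ
    G p = ℕ→ℚ (suc n C suc p) * bernoulli (n ∸ p)
    diagonal : b (r ℕ.+ 0) * pow[x-1] (r ℕ.+ 0) r ≡ b r
    diagonal = trans (cong (λ j → b j * pow[x-1] j r) (ℕP.+-identityʳ r)) (trans (cong (b r *_) (pow[x-1]-diag r)) (ℚP.*-identityʳ (b r)))
    term : ∀ p → p ≤ n → b (r ℕ.+ suc p) * pow[x-1] (r ℕ.+ suc p) r ≡ K * G p
    term p p≤n = trans (cong (λ j → b j * pow[x-1] j r) (ℕP.+-suc r p)) (powerSum-bernoulli-term r n p p≤n)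
    leading : ∀ n → - (signℚ (suc n) * (1/suc (r ℕ.+ n) * ℕ→ℚ (suc (r ℕ.+ n) C r)) * δ n 0) ≡ δ n 0
    leading zero    = begin
      - (- 1ℚ * (1/suc (r ℕ.+ 0) * ℕ→ℚ (suc (r ℕ.+ 0) C r)) * 1ℚ)   ≡⟨ cong (λ k → - (- 1ℚ * (1/suc k * ℕ→ℚ (suc k C r)) * 1ℚ)) (ℕP.+-identityʳ r) ⟩
      - (- 1ℚ * (1/suc r * ℕ→ℚ (suc r C r)) * 1ℚ)                   ≡⟨ cong (λ c → - (- 1ℚ * (1/suc r * ℕ→ℚ c) * 1ℚ)) (trans (sym (C-+-sym 1 r)) (nC1≡n (suc r))) ⟩
      - (- 1ℚ * (1/suc r * ℕ→ℚ (suc r)) * 1ℚ)                       ≡⟨ cong (λ x → - (- 1ℚ * x * 1ℚ)) (1/suc-inverse r) ⟩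
      1ℚ                                                             ∎
    leading (suc n) = solve 1 (λ x → :- (x :* con 0ℚ) := con 0ℚ) refl (signℚ (2 ℕ.+ n) * (1/suc (r ℕ.+ suc n) * ℕ→ℚ (suc (r ℕ.+ suc n) C r)))


powerSum-stirling-from : ∀ {m k} → k ≤ m → powerSum-stirling m (suc k) ≡ sumFromTo k m (λ l → S₂ m l * (1/suc l * σ⁺ l (suc k)))
powerSum-stirling-from {m} {k} k≤m = sumℚ≡sumFromTo (ℕP.m≤n⇒m≤1+n k≤m) λ l l<k → begin
  S₂ m l * (1/suc l * (s₁ l (suc k) + s₁ l k))   ≡⟨ cong₂ (λ x y → S₂ m l * (1/suc l * (x + y))) (s₁-vanish (ℕP.m<n⇒m<1+n l<k)) (s₁-vanish l<k) ⟩
  S₂ m l * (1/suc l * (0ℚ + 0ℚ))                 ≡⟨ cong (S₂ m l *_) (ℚP.*-zeroʳ (1/suc l)) ⟩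
  S₂ m l * 0ℚ                                    ≡⟨ ℚP.*-zeroʳ (S₂ m l) ⟩
  0ℚ                                             ∎
  where open ≡-Reasoning

powerSum-stirling≡bernoulli : ∀ m k → powerSum-stirling m (suc k) ≡ powerSum-bernoulli m (suc k)
powerSum-stirling≡bernoulli m k =
  x∙y⁻¹≈ε⇒x≈y _ _ (∇-zero⇒constant m difference ∇-difference difference-vanish (suc k) (s≤s z≤n))
  where
  difference : ℕ → ℚ
  difference j = powerSum-stirling m j - powerSum-bernoulli m j
  ∇-difference : ∀ r → r ≤ m → ∇ (2 ℕ.+ m) difference r ≡ 0ℚ
  ∇-difference r r≤m = trans (∇-sub (2 ℕ.+ m) (powerSum-stirling m) (powerSum-bernoulli m) r)
    (trans (cong₂ _-_ (∇-powerSum-stirling m r) (∇-powerSum-bernoulli m r r≤m)) (ℚP.+-inverseʳ (δ m r)))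
  difference-vanish : VanishesFrom difference (2 ℕ.+ m)
  difference-vanish j 2+m≤j = trans (cong₂ _-_ (powerSum-stirling-vanish m j 2+m≤j) (powerSum-bernoulli-vanish m j 2+m≤j)) (ℚP.+-inverseʳ 0ℚ)

theorem6 : (m k : ℕ) → k ≤ m →
    signℚ (m ∸ k) * ((+ 1 / suc m) * (ℕ→ℚ ((suc m) C (m ∸ k)) * bernoulli (m ∸ k)))
      ≡ sumFromTo k m (λ ℓ → ℕ→ℚ (stirling2 m ℓ) * ((+ 1 / suc ℓ)
          * (ℤ→ℚ (stirling1 ℓ (suc k)) + ℤ→ℚ (stirling1 ℓ k))))
theorem6 m k k≤m = begin
  signℚ (m ∸ k) * (1/suc m * (ℕ→ℚ (suc m C (m ∸ k)) * bernoulli (m ∸ k)))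
    ≡⟨ cong (λ c → signℚ (m ∸ k) * (1/suc m * (ℕ→ℚ c * bernoulli (m ∸ k)))) (sym (nCk≡nC[n∸k] (s≤s k≤m))) ⟩
  powerSum-bernoulli m (suc k)
    ≡⟨ sym (powerSum-stirling≡bernoulli m k) ⟩
  powerSum-stirling m (suc k)
    ≡⟨ powerSum-stirling-from k≤m ⟩
  sumFromTo k m (λ l → S₂ m l * (1/suc l * σ⁺ l (suc k))) ∎
  where open ≡-Reasoning
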